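{- For every labelled transition system $F\colon (L+\{\tau\})\to[S\to\mathcal P S]$ with internal action $\tau$, $\eta_S\le F^{b}(\tau)$; however, in general $F^{b}(\tau)\cdot F^{b}(\tau)\not\le F^{b}(\tau)$, i.e. there exist such $F$ for which $F^{b}(\tau)\cdot F^{b}(\tau)\le F^{b}(\tau)$ fails.
   Context: $L$ is a set of labels not containing $\tau$; write $s\xrightarrow{a}s'$ for $s'\in F(a)(s)$, and $x\xrightarrow{\tau^*}y$ iff there is a finite possibly empty chain $x\xrightarrow{\tau}\cdots\xrightarrow{\tau}y$ (with $x=y$ if empty). The branching saturation $F^{b}\colon (L+\{\tau\})\to[S\to\mathcal P(S\times S)]$ is $F^b(a)(s)=\{(s_1,s_2)\mid s\xrightarrow{\tau^*}s_1\xrightarrow{a}s_2,\text{ or }(a=\tau\text{ and }s=s_1=s_2)\}$. On $[S\to\mathcal P(S\times S)]$: $\eta_S(s)=\{(s,s)\}$; $(f\cdot g)(s)=\bigcup_{(x,y)\in f(s)}(g(x)\cup g(y))$; $f\le g$ iff $f(s)\subseteq g(s)$ for all $s$. -}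

module Defs where

open import Data.Product using (Σ; _×_; _,_; ∃-syntax)
open import Data.Sum using (_⊎_; inj₁; inj₂)
open import Data.Unit using (⊤; tt)
open import Relation.Binary.PropositionalEquality using (_≡_)

Lτ : Set → Set
Lτ L = L ⊎ ⊤

τ : {L : Set} → Lτ L
τ = inj₂ tt

𝒫 : Set → Set₁
𝒫 X = X → Set

LTS : Set → Set → Set₁
LTS L S = Lτ L → S → 𝒫 S

_⊢_─[_]→_ : {L S : Set} → LTS L S → S → Lτ L → S → Set
F ⊢ s ─[ a ]→ s' = F a s s'

data _⊢_─τ*→_ {L S : Set} (F : LTS L S) : S → S → Set where
  τ*-refl : ∀ {x} → F ⊢ x ─τ*→ x
  τ*-step : ∀ {x y z} → F ⊢ x ─[ τ ]→ y → F ⊢ y ─τ*→ z → F ⊢ x ─τ*→ z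

Rel2 : Set → Set₁
Rel2 S = S → 𝒫 (S × S)

Fᵇ : {L S : Set} → LTS L S → Lτ L → Rel2 S
Fᵇ F a s (s₁ , s₂) =
  ((F ⊢ s ─τ*→ s₁) × (F ⊢ s₁ ─[ a ]→ s₂))
  ⊎ ((a ≡ τ) × ((s ≡ s₁) × (s ≡ s₂)))

ηS : {S : Set} → Rel2 S
ηS s p = p ≡ (s , s)

_·_ : {S : Set} → Rel2 S → Rel2 S → Rel2 S
(f · g) s p = Σ _ λ xy → f s xy × (g (Data.Product.proj₁ xy) p ⊎ g (Data.Product.proj₂ xy) p)

_≤ᴿ_ : {S : Set} → Rel2 S → Rel2 S → Set
f ≤ᴿ g = ∀ s p → f s p → g s p

module Submission where

open import Defs
open import Data.Product using (Σ; _×_; _,_)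
open import Relation.Nullary using (¬_)
open import Data.Bool using (Bool; true; false)
open import Data.Empty using (⊥)
open import Data.Sum using (inj₁; inj₂)
open import Data.Unit using (⊤; tt)
open import Relation.Binary.PropositionalEquality using (_≡_; refl)

-- A τ-step s → t
-- followed by the idle pair (t , t) puts (t , t) in (Fᵇ τ · Fᵇ τ) s, whereas
-- (t , t) ∈ Fᵇ τ s needs s = t or a τ-step t → t; a single step
-- false → true admits neither.

ηS≤Fᵇτ : {L S : Set} (F : LTS L S) → ηS ≤ᴿ Fᵇ F τ
ηS≤Fᵇτ F s .(s , s) refl = inj₂ (refl , refl , refl)

single-τ-step : LTS ⊥ Bool
single-τ-step (inj₂ tt) false true = ⊤
single-τ-step _         _     _    = ⊥

τ-then-idle∈Fᵇτ·Fᵇτ : {L S : Set} (F : LTS L S) {s t : S} →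
                      F ⊢ s ─[ τ ]→ t → (Fᵇ F τ · Fᵇ F τ) s (t , t)
τ-then-idle∈Fᵇτ·Fᵇτ F {s} {t} s→t =
  (s , t) , inj₁ (τ*-refl , s→t) , inj₂ (ηS≤Fᵇτ F t (t , t) refl)

true∉Fᵇτ-false : ¬ Fᵇ single-τ-step τ false (true , true)
true∉Fᵇτ-false (inj₁ (_ , ()))
true∉Fᵇτ-false (inj₂ (_ , () , _))

Fᵇτ·Fᵇτ≰Fᵇτ : ¬ ((Fᵇ single-τ-step τ · Fᵇ single-τ-step τ) ≤ᴿ Fᵇ single-τ-step τ)
Fᵇτ·Fᵇτ≰Fᵇτ ≤ = true∉Fᵇτ-false
  (≤ false (true , true) (τ-then-idle∈Fᵇτ·Fᵇτ single-τ-step tt))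

mainTheorem15 :
    ((L S : Set) (F : LTS L S) → ηS ≤ᴿ Fᵇ F τ)
    × Σ Set (λ L → Σ Set (λ S → Σ (LTS L S) (λ F →
        ¬ ((Fᵇ F τ · Fᵇ F τ) ≤ᴿ Fᵇ F τ))))
mainTheorem15 = (λ L S → ηS≤Fᵇτ) , ⊥ , Bool , single-τ-step , Fᵇτ·Fᵇτ≰Fᵇτ
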